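{- Let $n\ge 4$ and let $D_n$ be the tree on vertex set $\{1,\ldots,n\}$ with edges $\{1,3\},\{2,3\}$ and $\{i,i+1\}$ for $3\le i\le n-1$, with adjacency matrix $A$. Let $W(D_n)=[e,Ae,\ldots,A^{n-1}e]$ ($e$ the all-ones vector of length $n$) and let $\hat W(D_n)$ be obtained from $W(D_n)$ by deleting its first row and last column. Then $W(D_n)$ and the $n\times n$ matrix $\begin{pmatrix}0&0\\ \hat W(D_n)&0\end{pmatrix}$ (first row zero, last column zero) have the same Smith normal form. In particular, $\operatorname{rank}W(D_n)=\operatorname{rank}\hat W(D_n)$.
   Context: The Smith normal form of an integral square matrix $M$ is the diagonal matrix $\operatorname{diag}[d_1,\ldots,d_n]$ with nonnegative $d_i$, $d_i\mid d_{i+1}$, obtained as $UMV$ for unimodular integer matrices $U,V$. -}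

module Defs where

open import Data.Nat as ℕ using (ℕ; zero; suc; _<?_)
open import Data.Fin as Fin using (Fin; zero; suc; toℕ; inject₁; fromℕ<)
open import Data.Integer as ℤ using (ℤ; +_; 0ℤ; 1ℤ)
open import Data.Integer.Divisibility using (_∣_)
open import Data.Bool using (Bool; true; false; if_then_else_; _∧_; _∨_)
open import Data.Product using (Σ; _×_; ∃)
open import Relation.Binary.PropositionalEquality using (_≡_; _≢_)
open import Relation.Nullary.Decidable using (⌊_⌋; yes; no)

Mat : ℕ → ℕ → Set
Mat m k = Fin m → Fin k → ℤ

sumFin : (n : ℕ) → (Fin n → ℤ) → ℤ
sumFin zero    f = 0ℤ
sumFin (suc n) f = f zero ℤ.+ sumFin n (λ i → f (suc i))

_⊗_ : ∀ {a b c} → Mat a b → Mat b c → Mat a c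
_⊗_ {b = b} M N i j = sumFin b (λ k → M i k ℤ.* N k j)

I : (n : ℕ) → Mat n n
I n i j = if ⌊ i Fin.≟ j ⌋ then 1ℤ else 0ℤ

_≐_ : ∀ {a b} → Mat a b → Mat a b → Set
M ≐ N = ∀ i j → M i j ≡ N i j

Unimodular : (n : ℕ) → Mat n n → Set
Unimodular n U = Σ (Mat n n) λ V → ((U ⊗ V) ≐ I n) × ((V ⊗ U) ≐ I n)

IsSmithForm : (n : ℕ) → Mat n n → Set
IsSmithForm n D =
  (∀ i j → i ≢ j → D i j ≡ 0ℤ) ×
  (∀ i → 0ℤ ℤ.≤ D i i) ×
  (∀ (i j : Fin n) → toℕ j ≡ suc (toℕ i) → D i i ∣ D j j)

IsSNFof : (n : ℕ) → Mat n n → Mat n n → Set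
IsSNFof n M D =
  IsSmithForm n D ×
  Σ (Mat n n) λ U → Σ (Mat n n) λ V →
    Unimodular n U × Unimodular n V × ((U ⊗ (M ⊗ V)) ≐ D)

SameSNF : (n : ℕ) → Mat n n → Mat n n → Set
SameSNF n M N = Σ (Mat n n) λ D → IsSNFof n M D × IsSNFof n N D

-- The tree D_n, vertices 1..n encoded 0-indexed as 0..n-1:
-- edges {1,3},{2,3} ↦ {0,2},{1,2}; {i,i+1} (3 ≤ i ≤ n-1) ↦ {a,a+1} (2 ≤ a ≤ n-2).
edgeDir : ℕ → ℕ → Bool
edgeDir a b =
  (⌊ a ℕ.≟ 0 ⌋ ∧ ⌊ b ℕ.≟ 2 ⌋) ∨
  (⌊ a ℕ.≟ 1 ⌋ ∧ ⌊ b ℕ.≟ 2 ⌋) ∨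
  (⌊ 2 ℕ.≤? a ⌋ ∧ ⌊ b ℕ.≟ suc a ⌋)

isEdge : ℕ → ℕ → Bool
isEdge a b = edgeDir a b ∨ edgeDir b a

adjD : (n : ℕ) → Mat n n
adjD n i j = if isEdge (toℕ i) (toℕ j) then 1ℤ else 0ℤ

powE : (n : ℕ) → ℕ → Fin n → ℤ
powE n zero    i = 1ℤ
powE n (suc k) i = sumFin n (λ j → adjD n i j ℤ.* powE n k j)

W : (n : ℕ) → Mat n n
W n i j = powE n (toℕ j) i

Ŵ : (m : ℕ) → Mat m m
Ŵ m i j = W (suc m) (suc i) (inject₁ j)

padded : (m : ℕ) → Mat (suc m) (suc m)
padded m zero    j = 0ℤ
padded m (suc i) j with toℕ j <? m
... | yes p = Ŵ m i (fromℕ< p)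
... | no  _ = 0ℤ

-- The leaves 1 and 2 of D_n are twins, so A preserves the vectors with equal first two
-- coordinates, and merging the twins turns A on such vectors into the adjacency operator of
-- a path with a doubled edge at vertex 0 and no vertex beyond m, where n = m + 1.  There the
-- Chebyshev vectors 2 T_k(A/2) e are computed by the method of images, and reflecting oddly
-- at m shows that 2 T_m(A/2) e = 0.  Since 2 T_m is monic of degree m, A^m e is an integer
-- combination of e, A e, …, A^(m-1) e: a unimodular column operation clears the last column
-- of W, after which the first two rows agree and subtracting the second from the first gives
-- [[0, 0], [Ŵ, 0]].  Equivalent matrices have the same Smith normal form, whose existence is
-- the usual Euclidean reduction of a pivot.
module Submission where

open import Data.Bool.Base using (if_then_else_)
open import Data.Empty using (⊥-elim)
open import Data.Fin.Base as Fin using (Fin; zero; suc; toℕ)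
import Data.Fin.Properties as Finₚ
open import Data.Integer.Base as ℤ using (ℤ; +_; -[1+_]; -_; 0ℤ; 1ℤ; -1ℤ; _+_; _*_; _-_)
import Data.Integer.Divisibility as Unsigned
open import Data.Integer.Divisibility.Signed
  using (_∣_; _∣?_; divides; ∣-refl; ∣⇒∣ᵤ; ∣m∣n⇒∣m+n; ∣n⇒∣m*n; ∣m⇒∣m*n)
open import Data.Integer.DivMod using (_/_; _%_; a≡a%n+[a/n]*n; n%d<d)
import Data.Integer.Properties as ℤₚ
open import Data.Integer.Tactic.RingSolver using (solve-∀)
open import Data.List.Base using (List; []; _∷_; foldr)
open import Data.Nat.Base as ℕ using (ℕ; zero; suc; _≤_; _<_; _∸_; ∣_-_∣; z≤n; s≤s)
open import Data.Nat.Induction using (<-wellFounded)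
import Data.Nat.Properties as ℕₚ
open import Data.Product using (Σ; ∃; ∃₂; _×_; _,_; proj₁; proj₂)
open import Data.Sum using (_⊎_; inj₁; inj₂)
open import Induction.WellFounded using (Acc; acc)
open import Relation.Binary.PropositionalEquality
open import Relation.Nullary using (¬_; yes; no)
open import Relation.Unary using (Decidable)

open import Algebra.Properties.Semiring.Sum ℤₚ.+-*-semiring
  using (sum; sum-cong-≗; ∑-distrib-+; ∑-comm; *-distribˡ-sum; sum-replicate-zero; sum-init-last)

open import Defs

open ≡-Reasoning

sumFin≡sum : ∀ n (f : Fin n → ℤ) → sumFin n f ≡ sum f
sumFin≡sum zero    f = refl
sumFin≡sum (suc n) f = cong (_+_ (f zero)) (sumFin≡sum n (λ i → f (suc i)))

sumFin-cong : ∀ n {f g : Fin n → ℤ} → (∀ i → f i ≡ g i) → sumFin n f ≡ sumFin n g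
sumFin-cong n {f} {g} f≗g = begin
  sumFin n f ≡⟨ sumFin≡sum n f ⟩
  sum f      ≡⟨ sum-cong-≗ f≗g ⟩
  sum g      ≡⟨ sumFin≡sum n g ⟨
  sumFin n g ∎

sumFin-zero : ∀ n → sumFin n (λ _ → 0ℤ) ≡ 0ℤ
sumFin-zero n = trans (sumFin≡sum n _) (sum-replicate-zero n)

sumFin-+ : ∀ n (f g : Fin n → ℤ) → sumFin n (λ i → f i + g i) ≡ sumFin n f + sumFin n g
sumFin-+ n f g = begin
  sumFin n (λ i → f i + g i) ≡⟨ sumFin≡sum n _ ⟩
  sum (λ i → f i + g i)      ≡⟨ ∑-distrib-+ f g ⟩
  sum f + sum g              ≡⟨ cong₂ _+_ (sumFin≡sum n f) (sumFin≡sum n g) ⟨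
  sumFin n f + sumFin n g    ∎

sumFin-*ˡ : ∀ n x (f : Fin n → ℤ) → sumFin n (λ i → x * f i) ≡ x * sumFin n f
sumFin-*ˡ n x f = begin
  sumFin n (λ i → x * f i) ≡⟨ sumFin≡sum n _ ⟩
  sum (λ i → x * f i)      ≡⟨ *-distribˡ-sum x f ⟨
  x * sum f                ≡⟨ cong (x *_) (sumFin≡sum n f) ⟨
  x * sumFin n f           ∎

sumFin-comm : ∀ a b (f : Fin a → Fin b → ℤ) →
              sumFin a (λ i → sumFin b (f i)) ≡ sumFin b (λ j → sumFin a (λ i → f i j))
sumFin-comm a b f = begin
  sumFin a (λ i → sumFin b (f i))         ≡⟨ sumFin-cong a (λ i → sumFin≡sum b (f i)) ⟩
  sumFin a (λ i → sum (f i))              ≡⟨ sumFin≡sum a _ ⟩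
  sum (λ i → sum (f i))                   ≡⟨ ∑-comm f ⟩
  sum (λ j → sum (λ i → f i j))           ≡⟨ sumFin≡sum b _ ⟨
  sumFin b (λ j → sum (λ i → f i j))      ≡⟨ sumFin-cong b (λ j → sumFin≡sum a (λ i → f i j)) ⟨
  sumFin b (λ j → sumFin a (λ i → f i j)) ∎

sumFin-init-last : ∀ n (f : Fin (suc n) → ℤ) →
                   sumFin (suc n) f ≡ sumFin n (λ i → f (Fin.inject₁ i)) + f (Fin.fromℕ n)
sumFin-init-last n f = begin
  sumFin (suc n) f                                     ≡⟨ sumFin≡sum (suc n) f ⟩
  sum f                                                ≡⟨ sum-init-last f ⟩
  sum (λ i → f (Fin.inject₁ i)) + f (Fin.fromℕ n)      ≡⟨ cong (_+ f (Fin.fromℕ n)) (sumFin≡sum n _) ⟨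
  sumFin n (λ i → f (Fin.inject₁ i)) + f (Fin.fromℕ n) ∎

I-diag : ∀ {n} (i : Fin n) → I n i i ≡ 1ℤ
I-diag i with i Finₚ.≟ i
... | yes _  = refl
... | no i≢i = ⊥-elim (i≢i refl)

I-off : ∀ {n} {i j : Fin n} → i ≢ j → I n i j ≡ 0ℤ
I-off {i = i} {j} i≢j with i Finₚ.≟ j
... | yes i≡j = ⊥-elim (i≢j i≡j)
... | no _    = refl

I-sym : ∀ {n} (i j : Fin n) → I n i j ≡ I n j i
I-sym i j with i Finₚ.≟ j | j Finₚ.≟ i
... | yes _   | yes _   = refl
... | no _    | no _    = refl
... | yes i≡j | no j≢i  = ⊥-elim (j≢i (sym i≡j))
... | no i≢j  | yes j≡i = ⊥-elim (i≢j (sym j≡i))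

I-suc : ∀ {n} (i j : Fin n) → I (suc n) (suc i) (suc j) ≡ I n i j
I-suc i j with i Finₚ.≟ j
... | yes _ = refl
... | no _  = refl

sumFin-Iˡ : ∀ {n} (i : Fin n) (f : Fin n → ℤ) → sumFin n (λ k → I n i k * f k) ≡ f i
sumFin-Iˡ {suc n} zero f = begin
  1ℤ * f zero + sumFin n (λ k → 0ℤ * f (suc k))
    ≡⟨ cong₂ _+_ (ℤₚ.*-identityˡ (f zero)) (sumFin-zero n) ⟩
  f zero + 0ℤ
    ≡⟨ ℤₚ.+-identityʳ (f zero) ⟩
  f zero ∎
sumFin-Iˡ {suc n} (suc i) f = begin
  0ℤ * f zero + sumFin n (λ k → I (suc n) (suc i) (suc k) * f (suc k))
    ≡⟨ cong (_+_ 0ℤ) (sumFin-cong n (λ k → cong (_* f (suc k)) (I-suc i k))) ⟩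
  0ℤ + sumFin n (λ k → I n i k * f (suc k))
    ≡⟨ ℤₚ.+-identityˡ _ ⟩
  sumFin n (λ k → I n i k * f (suc k))
    ≡⟨ sumFin-Iˡ i (λ k → f (suc k)) ⟩
  f (suc i) ∎

sumFin-Iʳ : ∀ {n} (i : Fin n) (f : Fin n → ℤ) → sumFin n (λ k → f k * I n k i) ≡ f i
sumFin-Iʳ {n} i f =
  trans (sumFin-cong n (λ k → trans (ℤₚ.*-comm (f k) _) (cong (_* f k) (I-sym k i)))) (sumFin-Iˡ i f)

module _ {a b : ℕ} {M N : Mat a b} where

  ≐-sym : M ≐ N → N ≐ M
  ≐-sym M≐N i j = sym (M≐N i j)

≐-trans : ∀ {a b} {M N P : Mat a b} → M ≐ N → N ≐ P → M ≐ P
≐-trans M≐N N≐P i j = trans (M≐N i j) (N≐P i j)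

_ᵀ : ∀ {a b} → Mat a b → Mat b a
(M ᵀ) i j = M j i

module _ {a b c : ℕ} where

  ⊗-congˡ : {M M′ : Mat a b} (N : Mat b c) → M ≐ M′ → (M ⊗ N) ≐ (M′ ⊗ N)
  ⊗-congˡ N M≐M′ i j = sumFin-cong b (λ k → cong (_* N k j) (M≐M′ i k))

  ⊗-congʳ : (M : Mat a b) {N N′ : Mat b c} → N ≐ N′ → (M ⊗ N) ≐ (M ⊗ N′)
  ⊗-congʳ M N≐N′ i j = sumFin-cong b (λ k → cong (M i k *_) (N≐N′ k j))

  ᵀ-⊗ : (M : Mat a b) (N : Mat b c) → ((M ⊗ N) ᵀ) ≐ ((N ᵀ) ⊗ (M ᵀ))
  ᵀ-⊗ M N i j = sumFin-cong b (λ k → ℤₚ.*-comm (M j k) (N k i))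

⊗-assoc : ∀ {a b c d} (L : Mat a b) (M : Mat b c) (N : Mat c d) → ((L ⊗ M) ⊗ N) ≐ (L ⊗ (M ⊗ N))
⊗-assoc {b = b} {c} L M N i j = begin
  sumFin c (λ k → sumFin b (λ l → L i l * M l k) * N k j)
    ≡⟨ sumFin-cong c (λ k → trans (ℤₚ.*-comm _ (N k j)) (sym (sumFin-*ˡ b (N k j) _))) ⟩
  sumFin c (λ k → sumFin b (λ l → N k j * (L i l * M l k)))
    ≡⟨ sumFin-comm c b _ ⟩
  sumFin b (λ l → sumFin c (λ k → N k j * (L i l * M l k)))
    ≡⟨ sumFin-cong b (λ l → trans (sumFin-cong c (λ k → reassoc (N k j) (L i l) (M l k)))
                                  (sumFin-*ˡ c (L i l) _)) ⟩
  sumFin b (λ l → L i l * sumFin c (λ k → M l k * N k j)) ∎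
  where
  reassoc : ∀ x y z → x * (y * z) ≡ y * (z * x)
  reassoc = solve-∀

⊗-identityˡ : ∀ {a b} (M : Mat a b) → (I a ⊗ M) ≐ M
⊗-identityˡ M i j = sumFin-Iˡ i (λ k → M k j)

⊗-identityʳ : ∀ {a b} (M : Mat a b) → (M ⊗ I b) ≐ M
⊗-identityʳ M i j = sumFin-Iʳ j (M i)

Unimodular-I : ∀ n → Unimodular n (I n)
Unimodular-I n = I n , ⊗-identityˡ (I n) , ⊗-identityˡ (I n)

Unimodular-⊗ : ∀ {n} {U V : Mat n n} → Unimodular n U → Unimodular n V → Unimodular n (U ⊗ V)
Unimodular-⊗ {n} {U} {V} (U⁻¹ , UU⁻¹ , U⁻¹U) (V⁻¹ , VV⁻¹ , V⁻¹V) =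
  V⁻¹ ⊗ U⁻¹ , cancel U V UU⁻¹ VV⁻¹ , cancel V⁻¹ U⁻¹ V⁻¹V U⁻¹U
  where
  cancel : (X Y : Mat n n) {X′ Y′ : Mat n n} →
           (X ⊗ X′) ≐ I n → (Y ⊗ Y′) ≐ I n → ((X ⊗ Y) ⊗ (Y′ ⊗ X′)) ≐ I n
  cancel X Y {X′} {Y′} XX′≐I YY′≐I i j = begin
    ((X ⊗ Y) ⊗ (Y′ ⊗ X′)) i j ≡⟨ ⊗-assoc X Y (Y′ ⊗ X′) i j ⟩
    (X ⊗ (Y ⊗ (Y′ ⊗ X′))) i j ≡⟨ ⊗-congʳ X (≐-sym (⊗-assoc Y Y′ X′)) i j ⟩
    (X ⊗ ((Y ⊗ Y′) ⊗ X′)) i j ≡⟨ ⊗-congʳ X (⊗-congˡ X′ YY′≐I) i j ⟩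
    (X ⊗ (I n ⊗ X′)) i j      ≡⟨ ⊗-congʳ X (⊗-identityˡ X′) i j ⟩
    (X ⊗ X′) i j              ≡⟨ XX′≐I i j ⟩
    I n i j                   ∎

Unimodular-ᵀ : ∀ {n} {U : Mat n n} → Unimodular n U → Unimodular n (U ᵀ)
Unimodular-ᵀ {n} {U} (U⁻¹ , UU⁻¹ , U⁻¹U) = U⁻¹ ᵀ , flip U⁻¹ U U⁻¹U , flip U U⁻¹ UU⁻¹
  where
  flip : (X Y : Mat n n) → (X ⊗ Y) ≐ I n → ((Y ᵀ) ⊗ (X ᵀ)) ≐ I n
  flip X Y XY≐I i j = trans (sym (ᵀ-⊗ X Y i j)) (trans (XY≐I j i) (I-sym j i))

infix 4 _∼_

-- A record rather than a Σ-type so that Agda can infer the matrices it relates.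
record _∼_ {n} (M N : Mat n n) : Set where
  constructor equivalence
  field
    {U V} : Mat n n
    U-uni : Unimodular n U
    V-uni : Unimodular n V
    UMV≐N : (U ⊗ (M ⊗ V)) ≐ N

module _ {n : ℕ} where

  ∼-reflexive : {M N : Mat n n} → M ≐ N → M ∼ N
  ∼-reflexive {M} M≐N = equivalence (Unimodular-I n) (Unimodular-I n)
    λ i j → trans (⊗-identityˡ (M ⊗ I n) i j) (trans (⊗-identityʳ M i j) (M≐N i j))

  ∼-refl : {M : Mat n n} → M ∼ M
  ∼-refl = ∼-reflexive (λ _ _ → refl)

  ∼-trans : {L M N : Mat n n} → L ∼ M → M ∼ N → L ∼ N
  ∼-trans {L} {M} {N} (equivalence {U} {V} U-uni V-uni ULV≐M)
                      (equivalence {U′} {V′} U′-uni V′-uni U′MV′≐N) =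
    equivalence (Unimodular-⊗ U′-uni U-uni) (Unimodular-⊗ V-uni V′-uni) λ i j → begin
      ((U′ ⊗ U) ⊗ (L ⊗ (V ⊗ V′))) i j ≡⟨ ⊗-assoc U′ U (L ⊗ (V ⊗ V′)) i j ⟩
      (U′ ⊗ (U ⊗ (L ⊗ (V ⊗ V′)))) i j ≡⟨ ⊗-congʳ U′ (⊗-congʳ U (≐-sym (⊗-assoc L V V′))) i j ⟩
      (U′ ⊗ (U ⊗ ((L ⊗ V) ⊗ V′))) i j ≡⟨ ⊗-congʳ U′ (≐-sym (⊗-assoc U (L ⊗ V) V′)) i j ⟩
      (U′ ⊗ ((U ⊗ (L ⊗ V)) ⊗ V′)) i j ≡⟨ ⊗-congʳ U′ (⊗-congˡ V′ ULV≐M) i j ⟩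
      (U′ ⊗ (M ⊗ V′)) i j             ≡⟨ U′MV′≐N i j ⟩
      N i j                           ∎

  ∼-respʳ : {M N N′ : Mat n n} → M ∼ N → N ≐ N′ → M ∼ N′
  ∼-respʳ M∼N N≐N′ = ∼-trans M∼N (∼-reflexive N≐N′)

  ∼-ᵀ : {M N : Mat n n} → M ∼ N → (M ᵀ) ∼ (N ᵀ)
  ∼-ᵀ {M} {N} (equivalence {U} {V} U-uni V-uni UMV≐N) =
    equivalence (Unimodular-ᵀ V-uni) (Unimodular-ᵀ U-uni) λ i j → begin
      ((V ᵀ) ⊗ ((M ᵀ) ⊗ (U ᵀ))) i j ≡⟨ ⊗-congʳ (V ᵀ) (≐-sym (ᵀ-⊗ U M)) i j ⟩
      ((V ᵀ) ⊗ ((U ⊗ M) ᵀ)) i j     ≡⟨ ᵀ-⊗ (U ⊗ M) V i j ⟨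
      ((U ⊗ M) ⊗ V) j i             ≡⟨ ⊗-assoc U M V j i ⟩
      (U ⊗ (M ⊗ V)) j i             ≡⟨ UMV≐N j i ⟩
      N j i                         ∎

  ∼-⊗ˡ : (U M : Mat n n) → Unimodular n U → M ∼ (U ⊗ M)
  ∼-⊗ˡ U M U-uni = equivalence U-uni (Unimodular-I n) (⊗-congʳ U (⊗-identityʳ M))

  ∼-⊗ʳ : (M V : Mat n n) → Unimodular n V → M ∼ (M ⊗ V)
  ∼-⊗ʳ M V V-uni = equivalence (Unimodular-I n) V-uni (⊗-identityˡ (M ⊗ V))

transvection : ∀ {n} → Fin n → (Fin n → ℤ) → Mat n n
transvection {n} ℓ d i j = I n i j + I n j ℓ * d i

module _ {n : ℕ} (ℓ : Fin n) (d : Fin n → ℤ) where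

  transvection-⊗ : (X : Mat n n) → ∀ i j → (transvection ℓ d ⊗ X) i j ≡ X i j + d i * X ℓ j
  transvection-⊗ X i j = begin
    sumFin n (λ k → (I n i k + I n k ℓ * d i) * X k j)
      ≡⟨ sumFin-cong n (λ k → trans (cong (λ δ → (I n i k + δ * d i) * X k j) (I-sym k ℓ))
                                    (expand (I n i k) (I n ℓ k) (d i) (X k j))) ⟩
    sumFin n (λ k → I n i k * X k j + d i * (I n ℓ k * X k j))
      ≡⟨ sumFin-+ n _ _ ⟩
    sumFin n (λ k → I n i k * X k j) + sumFin n (λ k → d i * (I n ℓ k * X k j))
      ≡⟨ cong₂ _+_ (sumFin-Iˡ i (λ k → X k j))
                   (trans (sumFin-*ˡ n (d i) _) (cong (d i *_) (sumFin-Iˡ ℓ (λ k → X k j)))) ⟩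
    X i j + d i * X ℓ j ∎
    where
    expand : ∀ a b c x → (a + b * c) * x ≡ a * x + c * (b * x)
    expand = solve-∀

  ⊗-transvection : (X : Mat n n) → ∀ i j →
                   (X ⊗ transvection ℓ d) i j ≡ X i j + I n j ℓ * sumFin n (λ k → X i k * d k)
  ⊗-transvection X i j = begin
    sumFin n (λ k → X i k * (I n k j + I n j ℓ * d k))
      ≡⟨ sumFin-cong n (λ k → expand (X i k) (I n k j) (I n j ℓ) (d k)) ⟩
    sumFin n (λ k → X i k * I n k j + I n j ℓ * (X i k * d k))
      ≡⟨ sumFin-+ n _ _ ⟩
    sumFin n (λ k → X i k * I n k j) + sumFin n (λ k → I n j ℓ * (X i k * d k))
      ≡⟨ cong₂ _+_ (sumFin-Iʳ j (X i)) (sumFin-*ˡ n (I n j ℓ) _) ⟩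
    X i j + I n j ℓ * sumFin n (λ k → X i k * d k) ∎
    where
    expand : ∀ x a b y → x * (a + b * y) ≡ x * a + b * (x * y)
    expand = solve-∀

transvection-inverse : ∀ {n} (ℓ : Fin n) {d d′ : Fin n → ℤ} →
                       d′ ℓ ≡ 0ℤ → (∀ i → d i + d′ i ≡ 0ℤ) →
                       (transvection ℓ d ⊗ transvection ℓ d′) ≐ I n
transvection-inverse {n} ℓ {d} {d′} d′ℓ≡0 d+d′≡0 i j = begin
  (transvection ℓ d ⊗ transvection ℓ d′) i j
    ≡⟨ transvection-⊗ ℓ d (transvection ℓ d′) i j ⟩
  I n i j + I n j ℓ * d′ i + d i * (I n ℓ j + I n j ℓ * d′ ℓ)
    ≡⟨ cong₂ (λ δ x → I n i j + I n j ℓ * d′ i + d i * (δ + I n j ℓ * x)) (I-sym ℓ j) d′ℓ≡0 ⟩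
  I n i j + I n j ℓ * d′ i + d i * (I n j ℓ + I n j ℓ * 0ℤ)
    ≡⟨ collect (I n i j) (I n j ℓ) (d i) (d′ i) ⟩
  I n i j + I n j ℓ * (d i + d′ i)
    ≡⟨ cong (λ x → I n i j + I n j ℓ * x) (d+d′≡0 i) ⟩
  I n i j + I n j ℓ * 0ℤ
    ≡⟨ collect-zero (I n i j) (I n j ℓ) ⟩
  I n i j ∎
  where
  collect : ∀ a b x y → a + b * y + x * (b + b * 0ℤ) ≡ a + b * (x + y)
  collect = solve-∀
  collect-zero : ∀ a b → a + b * 0ℤ ≡ a
  collect-zero = solve-∀

Unimodular-transvection : ∀ {n} (ℓ : Fin n) (d : Fin n → ℤ) → d ℓ ≡ 0ℤ →
                          Unimodular n (transvection ℓ d)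
Unimodular-transvection ℓ d dℓ≡0 = transvection ℓ (λ i → - d i) ,
  transvection-inverse ℓ (cong -_ dℓ≡0) (λ i → ℤₚ.+-inverseʳ (d i)) ,
  transvection-inverse ℓ dℓ≡0 (λ i → ℤₚ.+-inverseˡ (d i))

-- Existence of the Smith normal form

∀-or-counterexample : ∀ {n} {P : Fin n → Set} → Decidable P → (∀ i → P i) ⊎ ∃ λ i → ¬ P i
∀-or-counterexample {n} {P} P? with Finₚ.all? P?
... | yes ∀P = inj₁ ∀P
... | no ¬∀P = inj₂ (Finₚ.¬∀⟶∃¬ n P P? ¬∀P)

∀₂-or-counterexample : ∀ {n} {P : Fin n → Fin n → Set} → (∀ i → Decidable (P i)) →
                       (∀ i j → P i j) ⊎ ∃₂ λ i j → ¬ P i j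
∀₂-or-counterexample {n} {P} P? with ∀-or-counterexample (λ i → Finₚ.all? (P? i))
... | inj₁ ∀P         = inj₁ ∀P
... | inj₂ (i , ¬∀Pi) = inj₂ (i , Finₚ.¬∀⟶∃¬ n (P i) (P? i) ¬∀Pi)

module _ {n : ℕ} where

  private
    Sq = Mat (suc n) (suc n)

  CrossCleared : Sq → Set
  CrossCleared N = (∀ j → N zero (suc j) ≡ 0ℤ) × (∀ i → N (suc i) zero ≡ 0ℤ)

  PivotBlock : Sq → Set
  PivotBlock N = CrossCleared N × (∀ i j → N zero zero ∣ N (suc i) (suc j))

  HasPivotBlock : Sq → Set
  HasPivotBlock M = Σ Sq λ N → M ∼ N × PivotBlock N

  SmallerPivot : Sq → Set
  SmallerPivot M =
    Σ Sq λ M′ → M ∼ M′ × M′ zero zero ≢ 0ℤ × ℤ.∣ M′ zero zero ∣ < ℤ.∣ M zero zero ∣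

  SmallerPivot-∼ : {M M′ : Sq} → M ∼ M′ → M′ zero zero ≡ M zero zero →
                   SmallerPivot M′ → SmallerPivot M
  SmallerPivot-∼ M∼M′ same (M″ , M′∼M″ , p≢0 , p<) =
    M″ , ∼-trans M∼M′ M′∼M″ , p≢0 , subst (λ a → ℤ.∣ M″ zero zero ∣ < ℤ.∣ a ∣) same p<

  SmallerPivot-ᵀ : {M : Sq} → SmallerPivot (M ᵀ) → SmallerPivot M
  SmallerPivot-ᵀ (M′ , Mᵀ∼M′ , p≢0 , p<) = M′ ᵀ , ∼-ᵀ Mᵀ∼M′ , p≢0 , p<

  HasPivotBlock-∼ : {M M′ : Sq} → M ∼ M′ → HasPivotBlock M′ → HasPivotBlock M
  HasPivotBlock-∼ M∼M′ (N , M′∼N , block) = N , ∼-trans M∼M′ M′∼N , block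

  moveRowToTop : (M : Sq) (ℓ : Fin (suc n)) → Σ Sq λ M′ → M ∼ M′ × (∀ j → M′ zero j ≡ M ℓ j)
  moveRowToTop M zero      = M , ∼-refl , λ _ → refl
  moveRowToTop M ℓ@(suc i) =
    M₃ , ∼-trans (∼-⊗ˡ add M up) (∼-trans (∼-⊗ˡ sub M₁ down) (∼-⊗ˡ add M₂ up)) , top
    where
    e₀ -eℓ : Fin (suc n) → ℤ
    e₀      = I (suc n) zero
    -eℓ k   = - I (suc n) ℓ k
    add = transvection ℓ e₀
    sub = transvection zero -eℓ
    up   = Unimodular-transvection ℓ e₀ refl
    down = Unimodular-transvection zero -eℓ refl
    M₁ = add ⊗ M
    M₂ = sub ⊗ M₁
    M₃ = add ⊗ M₂
    top : ∀ j → M₃ zero j ≡ M ℓ j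
    top j = begin
      M₃ zero j                    ≡⟨ transvection-⊗ ℓ e₀ M₂ zero j ⟩
      M₂ zero j + 1ℤ * M₂ ℓ j      ≡⟨ cong₂ (λ x y → x + 1ℤ * y) M₂₀ M₂ℓ ⟩
      a + 1ℤ * b + 1ℤ * - a        ≡⟨ cancel a b ⟩
      b                            ∎
      where
      a = M zero j
      b = M ℓ j
      cancel : ∀ a b → a + 1ℤ * b + 1ℤ * - a ≡ b
      cancel = solve-∀
      M₁₀ : M₁ zero j ≡ a + 1ℤ * b
      M₁₀ = transvection-⊗ ℓ e₀ M zero j
      M₂₀ : M₂ zero j ≡ a + 1ℤ * b
      M₂₀ = trans (transvection-⊗ zero -eℓ M₁ zero j) (trans (ℤₚ.+-identityʳ _) M₁₀)
      M₂ℓ : M₂ ℓ j ≡ - a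
      M₂ℓ = begin
        M₂ ℓ j                                ≡⟨ transvection-⊗ zero -eℓ M₁ ℓ j ⟩
        M₁ ℓ j + - I (suc n) ℓ ℓ * M₁ zero j  ≡⟨ cong₂ (λ x δ → x + - δ * M₁ zero j)
                                                       (transvection-⊗ ℓ e₀ M ℓ j) (I-diag ℓ) ⟩
        b + 0ℤ + -1ℤ * M₁ zero j              ≡⟨ cong (λ x → b + 0ℤ + -1ℤ * x) M₁₀ ⟩
        b + 0ℤ + -1ℤ * (a + 1ℤ * b)           ≡⟨ negate a b ⟩
        - a                                   ∎
        where
        negate : ∀ a b → b + 0ℤ + -1ℤ * (a + 1ℤ * b) ≡ - a
        negate = solve-∀

  moveToPivot : (M : Sq) (i j : Fin (suc n)) → M i j ≢ 0ℤ → Σ Sq λ M′ → M ∼ M′ × M′ zero zero ≢ 0ℤ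
  moveToPivot M i j Mij≢0 =
    let (M₁ , M∼M₁ , top₁) = moveRowToTop M i
        (M₂ , M₁ᵀ∼M₂ , top₂) = moveRowToTop (M₁ ᵀ) j
    in M₂ ᵀ , ∼-trans M∼M₁ (∼-ᵀ M₁ᵀ∼M₂) ,
       λ pivot≡0 → Mij≢0 (trans (sym (trans (top₂ zero) (top₁ j))) pivot≡0)

  -- The remainder of M ℓ 0 modulo the pivot, moved to the top, becomes the new pivot.
  reduceByRow : (M : Sq) (ℓ : Fin (suc n)) → M zero zero ≢ 0ℤ → ¬ (M zero zero ∣ M ℓ zero) →
                SmallerPivot M
  reduceByRow M zero      _   a∤a = ⊥-elim (a∤a ∣-refl)
  reduceByRow M ℓ@(suc i) a≢0 a∤b =
    let (M₂ , M₁∼M₂ , top) = moveRowToTop M₁ ℓ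
        pivot≡r = trans (top zero) M₁ℓ₀≡r
        M∼M₁ = ∼-⊗ˡ (transvection zero d) M (Unimodular-transvection zero d (ℤₚ.*-zeroʳ (- q)))
    in M₂ , ∼-trans M∼M₁ M₁∼M₂ ,
       (λ pivot≡0 → r≢0 (trans (sym pivot≡r) pivot≡0)) ,
       subst (λ x → ℤ.∣ x ∣ < ℤ.∣ a ∣) (sym pivot≡r) (n%d<d b a)
    where
    a = M zero zero
    b = M ℓ zero
    instance _ = ℤ.≢-nonZero a≢0
    q = b / a
    d : Fin (suc n) → ℤ
    d k = - q * I (suc n) ℓ k
    M₁ = transvection zero d ⊗ M
    M₁ℓ₀≡r : M₁ ℓ zero ≡ + (b % a)
    M₁ℓ₀≡r = begin
      M₁ ℓ zero                        ≡⟨ transvection-⊗ zero d M ℓ zero ⟩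
      b + - q * I (suc n) ℓ ℓ * a
        ≡⟨ cong₂ (λ x δ → x + - q * δ * a) (a≡a%n+[a/n]*n b a) (I-diag ℓ) ⟩
      + (b % a) + q * a + - q * 1ℤ * a ≡⟨ cancel (+ (b % a)) q a ⟩
      + (b % a)                        ∎
      where
      cancel : ∀ r q a → r + q * a + - q * 1ℤ * a ≡ r
      cancel = solve-∀
    r≢0 : + (b % a) ≢ 0ℤ
    r≢0 r≡0 = a∤b (divides q (begin
      b                 ≡⟨ a≡a%n+[a/n]*n b a ⟩
      + (b % a) + q * a ≡⟨ cong (_+ q * a) r≡0 ⟩
      0ℤ + q * a        ≡⟨ ℤₚ.+-identityˡ (q * a) ⟩
      q * a             ∎))

  reduceByColumn : (M : Sq) (ℓ : Fin (suc n)) → M zero zero ≢ 0ℤ → ¬ (M zero zero ∣ M zero ℓ) →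
                   SmallerPivot M
  reduceByColumn M ℓ a≢0 a∤b = SmallerPivot-ᵀ (reduceByRow (M ᵀ) ℓ a≢0 a∤b)

  clearColumn : (M : Sq) → (∀ i → M zero zero ∣ M i zero) →
                Σ Sq λ M′ → M ∼ M′ × (∀ j → M′ zero j ≡ M zero j) ×
                            (∀ i → M′ (suc i) zero ≡ 0ℤ)
  clearColumn M a∣col = M′ , ∼-⊗ˡ (transvection zero d) M (Unimodular-transvection zero d refl) , row₀ , col₀
    where
    d : Fin (suc n) → ℤ
    d zero    = 0ℤ
    d (suc i) = - _∣_.quotient (a∣col (suc i))
    M′ = transvection zero d ⊗ M
    row₀ : ∀ j → M′ zero j ≡ M zero j
    row₀ j = trans (transvection-⊗ zero d M zero j) (ℤₚ.+-identityʳ (M zero j))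
    col₀ : ∀ i → M′ (suc i) zero ≡ 0ℤ
    col₀ i = begin
      M′ (suc i) zero                     ≡⟨ transvection-⊗ zero d M (suc i) zero ⟩
      M (suc i) zero + - q * M zero zero  ≡⟨ cong (_+ - q * M zero zero) (_∣_.equality (a∣col (suc i))) ⟩
      q * M zero zero + - q * M zero zero ≡⟨ cancel q (M zero zero) ⟩
      0ℤ                                  ∎
      where
      q = _∣_.quotient (a∣col (suc i))
      cancel : ∀ q a → q * a + - q * a ≡ 0ℤ
      cancel = solve-∀

  clearCross : (M : Sq) → (∀ i → M zero zero ∣ M i zero) → (∀ j → M zero zero ∣ M zero j) →
               Σ Sq λ N → M ∼ N × N zero zero ≡ M zero zero × CrossCleared N
  clearCross M a∣col a∣row =
    let (M₁ , M∼M₁ , row₁ , col₁) = clearColumn M a∣col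
        a∣row₁ = λ j → subst₂ _∣_ (sym (row₁ zero)) (sym (row₁ j)) (a∣row j)
        (M₂ , M₁ᵀ∼M₂ , row₂ , col₂) = clearColumn (M₁ ᵀ) a∣row₁
    in M₂ ᵀ , ∼-trans M∼M₁ (∼-ᵀ M₁ᵀ∼M₂) , trans (row₂ zero) (row₁ zero) ,
       col₂ , λ i → trans (row₂ (suc i)) (col₁ i)

  reduceInner : (N : Sq) (i j : Fin n) → N zero zero ≢ 0ℤ → CrossCleared N →
                ¬ (N zero zero ∣ N (suc i) (suc j)) → SmallerPivot N
  reduceInner N i j a≢0 (row₀ , col₀) a∤b =
    SmallerPivot-∼ (∼-⊗ˡ (transvection (suc i) e₀) N (Unimodular-transvection (suc i) e₀ refl)) pivot
      (reduceByColumn N′ (suc j) (λ p≡0 → a≢0 (trans (sym pivot) p≡0))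
                                 (λ a∣b → a∤b (subst₂ _∣_ pivot entry a∣b)))
    where
    e₀ = I (suc n) zero
    N′ = transvection (suc i) e₀ ⊗ N
    pivot : N′ zero zero ≡ N zero zero
    pivot = begin
      N′ zero zero                      ≡⟨ transvection-⊗ (suc i) e₀ N zero zero ⟩
      N zero zero + 1ℤ * N (suc i) zero ≡⟨ cong (λ x → N zero zero + 1ℤ * x) (col₀ i) ⟩
      N zero zero + 1ℤ * 0ℤ             ≡⟨ ℤₚ.+-identityʳ (N zero zero) ⟩
      N zero zero                       ∎
    entry : N′ zero (suc j) ≡ N (suc i) (suc j)
    entry = begin
      N′ zero (suc j)                         ≡⟨ transvection-⊗ (suc i) e₀ N zero (suc j) ⟩
      N zero (suc j) + 1ℤ * N (suc i) (suc j) ≡⟨ cong (_+ 1ℤ * N (suc i) (suc j)) (row₀ j) ⟩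
      0ℤ + 1ℤ * N (suc i) (suc j)             ≡⟨ ℤₚ.+-identityˡ _ ⟩
      1ℤ * N (suc i) (suc j)                  ≡⟨ ℤₚ.*-identityˡ _ ⟩
      N (suc i) (suc j)                       ∎

  pivotStep : (M : Sq) → M zero zero ≢ 0ℤ → SmallerPivot M ⊎ HasPivotBlock M
  pivotStep M a≢0 = byColumn (∀-or-counterexample (λ i → a ∣? M i zero))
    where
    a = M zero zero
    byInner : (N : Sq) → M ∼ N → N zero zero ≡ a → CrossCleared N →
              (∀ i j → N zero zero ∣ N (suc i) (suc j)) ⊎
              ∃₂ (λ i j → ¬ N zero zero ∣ N (suc i) (suc j)) →
              SmallerPivot M ⊎ HasPivotBlock M
    byInner N M∼N same cross (inj₁ a∣inner)       = inj₂ (N , M∼N , cross , a∣inner)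
    byInner N M∼N same cross (inj₂ (i , j , a∤b)) =
      inj₁ (SmallerPivot-∼ M∼N same (reduceInner N i j (λ p≡0 → a≢0 (trans (sym same) p≡0)) cross a∤b))
    byRow : (∀ i → a ∣ M i zero) → (∀ j → a ∣ M zero j) ⊎ ∃ (λ j → ¬ a ∣ M zero j) →
            SmallerPivot M ⊎ HasPivotBlock M
    byRow a∣col (inj₁ a∣row) =
      let (N , M∼N , same , cross) = clearCross M a∣col a∣row
      in byInner N M∼N same cross (∀₂-or-counterexample (λ i j → N zero zero ∣? N (suc i) (suc j)))
    byRow a∣col (inj₂ (j , a∤b)) = inj₁ (reduceByColumn M j a≢0 a∤b)
    byColumn : (∀ i → a ∣ M i zero) ⊎ ∃ (λ i → ¬ a ∣ M i zero) → SmallerPivot M ⊎ HasPivotBlock M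
    byColumn (inj₁ a∣col)     = byRow a∣col (∀-or-counterexample (λ j → a ∣? M zero j))
    byColumn (inj₂ (i , a∤b)) = inj₁ (reduceByRow M i a≢0 a∤b)

  hasPivotBlock-acc : (M : Sq) → M zero zero ≢ 0ℤ → Acc _<_ ℤ.∣ M zero zero ∣ → HasPivotBlock M
  hasPivotBlock-acc M a≢0 (acc smaller) with pivotStep M a≢0
  ... | inj₂ block                    = block
  ... | inj₁ (M′ , M∼M′ , a′≢0 , a′<a) =
    HasPivotBlock-∼ M∼M′ (hasPivotBlock-acc M′ a′≢0 (smaller a′<a))

  hasPivotBlock : (M : Sq) → HasPivotBlock M
  hasPivotBlock M with ∀₂-or-counterexample (λ i j → M i j ℤₚ.≟ 0ℤ)
  ... | inj₁ M≡0 =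
    M , ∼-refl , ((λ j → M≡0 zero (suc j)) , (λ i → M≡0 (suc i) zero)) ,
    λ i j → subst₂ _∣_ (sym (M≡0 zero zero)) (sym (M≡0 (suc i) (suc j))) ∣-refl
  ... | inj₂ (i , j , Mij≢0) =
    let (M′ , M∼M′ , p≢0) = moveToPivot M i j Mij≢0
    in HasPivotBlock-∼ M∼M′ (hasPivotBlock-acc M′ p≢0 (<-wellFounded _))

infixr 5 _⊕_

_⊕_ : ∀ {n} → ℤ → Mat n n → Mat (suc n) (suc n)
(d ⊕ X) zero    zero    = d
(d ⊕ X) zero    (suc j) = 0ℤ
(d ⊕ X) (suc i) zero    = 0ℤ
(d ⊕ X) (suc i) (suc j) = X i j

module _ {n : ℕ} where

  ⊕-⊗ : ∀ a b (X Y : Mat n n) → ((a ⊕ X) ⊗ (b ⊕ Y)) ≐ ((a * b) ⊕ (X ⊗ Y))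
  ⊕-⊗ a b X Y zero    zero    = trans (cong (_+_ (a * b)) (sumFin-zero n)) (ℤₚ.+-identityʳ (a * b))
  ⊕-⊗ a b X Y zero    (suc j) = cong₂ _+_ (ℤₚ.*-zeroʳ a) (sumFin-zero n)
  ⊕-⊗ a b X Y (suc i) zero    =
    trans (ℤₚ.+-identityˡ _) (trans (sumFin-cong n (λ k → ℤₚ.*-zeroʳ (X i k))) (sumFin-zero n))
  ⊕-⊗ a b X Y (suc i) (suc j) = ℤₚ.+-identityˡ _

  ⊕-cong : ∀ {a b} {X Y : Mat n n} → a ≡ b → X ≐ Y → (a ⊕ X) ≐ (b ⊕ Y)
  ⊕-cong a≡b X≐Y zero    zero    = a≡b
  ⊕-cong a≡b X≐Y zero    (suc j) = refl
  ⊕-cong a≡b X≐Y (suc i) zero    = refl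
  ⊕-cong a≡b X≐Y (suc i) (suc j) = X≐Y i j

  ⊕-I : (1ℤ ⊕ I n) ≐ I (suc n)
  ⊕-I zero    zero    = refl
  ⊕-I zero    (suc j) = refl
  ⊕-I (suc i) zero    = refl
  ⊕-I (suc i) (suc j) = sym (I-suc i j)

  Unimodular-⊕ : ∀ {s} {U : Mat n n} → s * s ≡ 1ℤ → Unimodular n U → Unimodular (suc n) (s ⊕ U)
  Unimodular-⊕ {s} {U} s²≡1 (U⁻¹ , UU⁻¹ , U⁻¹U) = s ⊕ U⁻¹ , invert UU⁻¹ , invert U⁻¹U
    where
    invert : {X Y : Mat n n} → (X ⊗ Y) ≐ I n → ((s ⊕ X) ⊗ (s ⊕ Y)) ≐ I (suc n)
    invert {X} {Y} XY≐I = ≐-trans (⊕-⊗ s s X Y) (≐-trans (⊕-cong s²≡1 XY≐I) ⊕-I)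

  ∼-⊕ : ∀ d {X Y : Mat n n} → X ∼ Y → (d ⊕ X) ∼ (d ⊕ Y)
  ∼-⊕ d {X} (equivalence {U} {V} U-uni V-uni UXV≐Y) =
    equivalence {U = 1ℤ ⊕ U} {V = 1ℤ ⊕ V} (Unimodular-⊕ refl U-uni) (Unimodular-⊕ refl V-uni)
      (≐-trans (⊗-congʳ (1ℤ ⊕ U) (⊕-⊗ d 1ℤ X V))
      (≐-trans (⊕-⊗ 1ℤ (d * 1ℤ) U (X ⊗ V))
               (⊕-cong (trans (ℤₚ.*-identityˡ (d * 1ℤ)) (ℤₚ.*-identityʳ d)) UXV≐Y)))

  ⊕-∼-∣∣ : ∀ d (X : Mat n n) → (d ⊕ X) ∼ (+ ℤ.∣ d ∣ ⊕ X)
  ⊕-∼-∣∣ (+ k)    X = ∼-refl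
  ⊕-∼-∣∣ -[1+ k ] X =
    equivalence {U = -1ℤ ⊕ I n} {V = I (suc n)} (Unimodular-⊕ refl (Unimodular-I n)) (Unimodular-I (suc n))
      (≐-trans (⊗-congʳ (-1ℤ ⊕ I n) (⊗-identityʳ (-[1+ k ] ⊕ X)))
      (≐-trans (⊕-⊗ -1ℤ -[1+ k ] (I n) X) (⊕-cong (ℤₚ.-1*i≡-i -[1+ k ]) (⊗-identityˡ X))))

  IsSmithForm-⊕ : ∀ d {D : Mat n n} → (∀ i → d ∣ D i i) → IsSmithForm n D →
                  IsSmithForm (suc n) (+ ℤ.∣ d ∣ ⊕ D)
  IsSmithForm-⊕ d {D} d∣D (diagonal , nonnegative , chain) = diagonal′ , nonnegative′ , chain′
    where
    D′ = + ℤ.∣ d ∣ ⊕ D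
    diagonal′ : ∀ i j → i ≢ j → D′ i j ≡ 0ℤ
    diagonal′ zero    zero    i≢i = ⊥-elim (i≢i refl)
    diagonal′ zero    (suc j) _   = refl
    diagonal′ (suc i) zero    _   = refl
    diagonal′ (suc i) (suc j) i≢j = diagonal i j (λ i≡j → i≢j (cong suc i≡j))
    nonnegative′ : ∀ i → 0ℤ ℤ.≤ D′ i i
    nonnegative′ zero    = ℤ.+≤+ z≤n
    nonnegative′ (suc i) = nonnegative i
    chain′ : ∀ (i j : Fin (suc n)) → toℕ j ≡ suc (toℕ i) → D′ i i Unsigned.∣ D′ j j
    chain′ zero    (suc zero)    _     = ∣⇒∣ᵤ (d∣D zero)
    chain′ (suc i) (suc j)       j≡1+i = chain i j (ℕₚ.suc-injective j≡1+i)
    chain′ zero    zero          ()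
    chain′ zero    (suc (suc j)) ()
    chain′ (suc i) zero          ()

∣-sumFin : ∀ n {d} (f : Fin n → ℤ) → (∀ k → d ∣ f k) → d ∣ sumFin n f
∣-sumFin zero    f d∣f = divides 0ℤ refl
∣-sumFin (suc n) f d∣f = ∣m∣n⇒∣m+n (d∣f zero) (∣-sumFin n (λ k → f (suc k)) (λ k → d∣f (suc k)))

∼-preserves-∣ : ∀ {n d} {X Y : Mat n n} → X ∼ Y → (∀ i j → d ∣ X i j) → ∀ i j → d ∣ Y i j
∼-preserves-∣ {n} {d} (equivalence {U} {V} _ _ UXV≐Y) d∣X i j =
  subst (d ∣_) (UXV≐Y i j)
    (∣-sumFin n _ (λ k → ∣n⇒∣m*n (U i k) (∣-sumFin n _ (λ l → ∣m⇒∣m*n (V l j) (d∣X k l)))))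

lowerRight : ∀ {n} → Mat (suc n) (suc n) → Mat n n
lowerRight N i j = N (suc i) (suc j)

CrossCleared-⊕ : ∀ {n} {N : Mat (suc n) (suc n)} → CrossCleared N → N ≐ (N zero zero ⊕ lowerRight N)
CrossCleared-⊕ (row₀ , col₀) zero    zero    = refl
CrossCleared-⊕ (row₀ , col₀) zero    (suc j) = row₀ j
CrossCleared-⊕ (row₀ , col₀) (suc i) zero    = col₀ i
CrossCleared-⊕ (row₀ , col₀) (suc i) (suc j) = refl

smithNormalForm : ∀ n (M : Mat n n) → Σ (Mat n n) λ D → IsSmithForm n D × M ∼ D
smithNormalForm zero    M = M , ((λ ()) , (λ ()) , λ ()) , ∼-refl
smithNormalForm (suc n) M =
  let (N , M∼N , cross , d∣lowerRight) = hasPivotBlock M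
      d = N zero zero
      (D , D-smith , lowerRight∼D) = smithNormalForm n (lowerRight N)
  in + ℤ.∣ d ∣ ⊕ D ,
     IsSmithForm-⊕ d (λ i → ∼-preserves-∣ lowerRight∼D d∣lowerRight i i) D-smith ,
     ∼-trans M∼N (∼-trans (∼-reflexive (CrossCleared-⊕ cross))
                          (∼-trans (∼-⊕ d lowerRight∼D) (⊕-∼-∣∣ d D)))

∼⇒SameSNF : ∀ {n} {M N : Mat n n} → M ∼ N → SameSNF n M N
∼⇒SameSNF {n} {M} {N} M∼N =
  let (D , D-smith , N∼D) = smithNormalForm n N
  in D , (D-smith , unpack (∼-trans M∼N N∼D)) , (D-smith , unpack N∼D)
  where
  unpack : ∀ {X Y : Mat n n} → X ∼ Y →
           Σ (Mat n n) λ U → Σ (Mat n n) λ V → Unimodular n U × Unimodular n V × ((U ⊗ (X ⊗ V)) ≐ Y)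
  unpack (equivalence U-uni V-uni UXV≐Y) = _ , _ , U-uni , V-uni , UXV≐Y

-- Krylov and Chebyshev vectors

infixr 7 _⊗ᵥ_

_⊗ᵥ_ : ∀ {n} → Mat n n → (Fin n → ℤ) → Fin n → ℤ
_⊗ᵥ_ {n} A v i = sumFin n (λ j → A i j * v j)

krylov : ∀ {n} → Mat n n → (Fin n → ℤ) → ℕ → Fin n → ℤ
krylov A x zero    = x
krylov A x (suc k) = A ⊗ᵥ krylov A x k

-- 2 T_k(A/2) x, where T_k is the k-th Chebyshev polynomial of the first kind.
chebyshev : ∀ {n} → Mat n n → (Fin n → ℤ) → ℕ → Fin n → ℤ
chebyshev A x zero          i = + 2 * x i
chebyshev A x (suc zero)      = A ⊗ᵥ x
chebyshev A x (suc (suc k)) i = (A ⊗ᵥ chebyshev A x (suc k)) i - chebyshev A x k i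

module _ {n : ℕ} (A : Mat n n) where

  ⊗ᵥ-cong : {v w : Fin n → ℤ} → (∀ i → v i ≡ w i) → ∀ i → (A ⊗ᵥ v) i ≡ (A ⊗ᵥ w) i
  ⊗ᵥ-cong v≗w i = sumFin-cong n (λ j → cong (A i j *_) (v≗w j))

  ⊗ᵥ-− : (v w : Fin n → ℤ) → ∀ i → (A ⊗ᵥ (λ l → v l - w l)) i ≡ (A ⊗ᵥ v) i - (A ⊗ᵥ w) i
  ⊗ᵥ-− v w i = begin
    sumFin n (λ l → A i l * (v l - w l))               ≡⟨ sumFin-cong n (λ l → distrib (A i l) (v l) (w l)) ⟩
    sumFin n (λ l → A i l * v l + -1ℤ * (A i l * w l)) ≡⟨ sumFin-+ n _ _ ⟩
    (A ⊗ᵥ v) i + sumFin n (λ l → -1ℤ * (A i l * w l))  ≡⟨ cong (_+_ ((A ⊗ᵥ v) i)) (sumFin-*ˡ n -1ℤ _) ⟩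
    (A ⊗ᵥ v) i + -1ℤ * (A ⊗ᵥ w) i                     ≡⟨ cong (_+_ ((A ⊗ᵥ v) i)) (ℤₚ.-1*i≡-i _) ⟩
    (A ⊗ᵥ v) i - (A ⊗ᵥ w) i                           ∎
    where
    distrib : ∀ a v w → a * (v - w) ≡ a * v + -1ℤ * (a * w)
    distrib = solve-∀

  ⊗ᵥ-combination : ∀ k (c : Fin k → ℤ) (u : Fin k → Fin n → ℤ) i →
                   (A ⊗ᵥ (λ l → sumFin k (λ t → c t * u t l))) i ≡ sumFin k (λ t → c t * (A ⊗ᵥ u t) i)
  ⊗ᵥ-combination k c u i = begin
    sumFin n (λ l → A i l * sumFin k (λ t → c t * u t l))
      ≡⟨ sumFin-cong n (λ l → sym (sumFin-*ˡ k (A i l) _)) ⟩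
    sumFin n (λ l → sumFin k (λ t → A i l * (c t * u t l)))
      ≡⟨ sumFin-comm n k _ ⟩
    sumFin k (λ t → sumFin n (λ l → A i l * (c t * u t l)))
      ≡⟨ sumFin-cong k (λ t → trans (sumFin-cong n (λ l → reassoc (A i l) (c t) (u t l)))
                                    (sumFin-*ˡ n (c t) _)) ⟩
    sumFin k (λ t → c t * sumFin n (λ l → A i l * u t l)) ∎
    where
    reassoc : ∀ a c u → a * (c * u) ≡ c * (a * u)
    reassoc = solve-∀

module KrylovSpan {m : ℕ} (A : Mat (suc m) (suc m)) (x : Fin (suc m) → ℤ) where

  private
    n = suc m
    P = krylov A x

  combination : (ℕ → ℤ) → Fin n → ℤ
  combination c i = sumFin n (λ j → c (toℕ j) * P (toℕ j) i)

  Span : ℕ → (Fin n → ℤ) → Set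
  Span k v = Σ (ℕ → ℤ) λ c → (∀ j → k ≤ j → c j ≡ 0ℤ) × (∀ i → v i ≡ combination c i)

  Span-cong : ∀ {k v w} → (∀ i → v i ≡ w i) → Span k v → Span k w
  Span-cong v≗w (c , c-support , v≡) = c , c-support , λ i → trans (sym (v≗w i)) (v≡ i)

  Span-weaken : ∀ {k k′ v} → k ≤ k′ → Span k v → Span k′ v
  Span-weaken k≤k′ (c , c-support , v≡) =
    c , (λ j k′≤j → c-support j (ℕₚ.≤-trans k≤k′ k′≤j)) , v≡

  Span-zero : ∀ {k} → Span k (λ _ → 0ℤ)
  Span-zero = (λ _ → 0ℤ) , (λ _ _ → refl) , λ i → sym (sumFin-zero n)

  Span-+ : ∀ {k v w} → Span k v → Span k w → Span k (λ i → v i + w i)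
  Span-+ {v = v} {w} (c , c-support , v≡) (c′ , c′-support , w≡) =
    (λ j → c j + c′ j) , (λ j k≤j → cong₂ _+_ (c-support j k≤j) (c′-support j k≤j)) , λ i → begin
      v i + w i
        ≡⟨ cong₂ _+_ (v≡ i) (w≡ i) ⟩
      combination c i + combination c′ i
        ≡⟨ sumFin-+ n (λ j → c (toℕ j) * P (toℕ j) i) (λ j → c′ (toℕ j) * P (toℕ j) i) ⟨
      sumFin n (λ j → c (toℕ j) * P (toℕ j) i + c′ (toℕ j) * P (toℕ j) i)
        ≡⟨ sumFin-cong n (λ j → sym (ℤₚ.*-distribʳ-+ (P (toℕ j) i) (c (toℕ j)) (c′ (toℕ j)))) ⟩
      combination (λ j → c j + c′ j) i ∎

  Span-scale : ∀ {k v} a → Span k v → Span k (λ i → a * v i)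
  Span-scale {v = v} a (c , c-support , v≡) =
    (λ j → a * c j) , (λ j k≤j → trans (cong (a *_) (c-support j k≤j)) (ℤₚ.*-zeroʳ a)) , λ i → begin
      a * v i
        ≡⟨ cong (a *_) (v≡ i) ⟩
      a * combination c i
        ≡⟨ sumFin-*ˡ n a (λ j → c (toℕ j) * P (toℕ j) i) ⟨
      sumFin n (λ j → a * (c (toℕ j) * P (toℕ j) i))
        ≡⟨ sumFin-cong n (λ j → sym (ℤₚ.*-assoc a (c (toℕ j)) (P (toℕ j) i))) ⟩
      combination (λ j → a * c j) i ∎

  Span-− : ∀ {k v w} → Span k v → Span k w → Span k (λ i → v i - w i)
  Span-− {v = v} {w} v∈ w∈ =
    Span-cong (λ i → cong (_+_ (v i)) (ℤₚ.-1*i≡-i (w i))) (Span-+ v∈ (Span-scale -1ℤ w∈))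

  -- Combinations only involve A^j x with j ≤ m; k ≤ m ensures the shifted one does not need
  -- A^(m+1) x.
  Span-shift : ∀ {k v} → k ≤ m → Span k v → Span (suc k) (A ⊗ᵥ v)
  Span-shift {k} {v} k≤m (c , c-support , v≡) = c′ , c′-support , λ i → begin
    (A ⊗ᵥ v) i
      ≡⟨ ⊗ᵥ-cong A v≡ i ⟩
    (A ⊗ᵥ combination c) i
      ≡⟨ ⊗ᵥ-combination A n (λ j → c (toℕ j)) (λ j → P (toℕ j)) i ⟩
    sumFin n (λ j → c (toℕ j) * P (suc (toℕ j)) i)
      ≡⟨ sumFin-init-last m (λ j → c (toℕ j) * P (suc (toℕ j)) i) ⟩
    sumFin m (λ j → c (toℕ (Fin.inject₁ j)) * P (suc (toℕ (Fin.inject₁ j))) i) +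
    c (toℕ last) * P (suc (toℕ last)) i
      ≡⟨ cong₂ _+_ (sumFin-cong m (λ j → cong (λ t → c t * P (suc t) i) (Finₚ.toℕ-inject₁ j)))
                   (cong (_* _) (trans (cong c (Finₚ.toℕ-fromℕ m)) (c-support m k≤m))) ⟩
    sumFin m (λ j → c (toℕ j) * P (suc (toℕ j)) i) + 0ℤ
      ≡⟨ ℤₚ.+-comm (sumFin m (λ j → c (toℕ j) * P (suc (toℕ j)) i)) 0ℤ ⟩
    combination c′ i ∎
    where
    last = Fin.fromℕ m
    c′ : ℕ → ℤ
    c′ zero    = 0ℤ
    c′ (suc j) = c j
    c′-support : ∀ j → suc k ≤ j → c′ j ≡ 0ℤ
    c′-support (suc j) (s≤s k≤j) = c-support j k≤j

  Span-krylov : ∀ j → j ≤ m → Span (suc j) (P j)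
  Span-krylov zero    _         = c , c-support , λ i → sym (begin
    1ℤ * x i + sumFin m (λ j → 0ℤ * P (suc (toℕ j)) i)
      ≡⟨ cong₂ _+_ (ℤₚ.*-identityˡ (x i)) (sumFin-zero m) ⟩
    x i + 0ℤ
      ≡⟨ ℤₚ.+-identityʳ (x i) ⟩
    x i ∎)
    where
    c : ℕ → ℤ
    c zero    = 1ℤ
    c (suc _) = 0ℤ
    c-support : ∀ j → 1 ≤ j → c j ≡ 0ℤ
    c-support (suc j) _ = refl
  Span-krylov (suc j) 1+j≤m = Span-shift 1+j≤m (Span-krylov j (ℕₚ.≤-trans (ℕₚ.n≤1+n j) 1+j≤m))

  chebyshev-span : ∀ k → k < m →
                   Span (suc k) (chebyshev A x k) × Span (suc k) (λ i → P (suc k) i - chebyshev A x (suc k) i)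
  chebyshev-span zero    _     =
    Span-scale (+ 2) (Span-krylov 0 z≤n) , Span-cong (λ i → sym (ℤₚ.+-inverseʳ (P 1 i))) Span-zero
  chebyshev-span (suc k) 1+k<m =
    let (Vₖ∈ , Rₖ₊₁∈) = chebyshev-span k (ℕₚ.<-trans (ℕₚ.n<1+n k) 1+k<m)
        1+k≤m = ℕₚ.<⇒≤ 1+k<m
    in Span-cong (λ i → a-[a-b]≡b (P (suc k) i) _)
                 (Span-− (Span-krylov (suc k) 1+k≤m) (Span-weaken (ℕₚ.n≤1+n _) Rₖ₊₁∈)) ,
       Span-cong R-step (Span-+ (Span-shift 1+k≤m Rₖ₊₁∈) (Span-weaken (ℕₚ.n≤1+n _) Vₖ∈))
    where
    V = chebyshev A x
    a-[a-b]≡b : ∀ a b → a - (a - b) ≡ b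
    a-[a-b]≡b = solve-∀
    R-step : ∀ i → (A ⊗ᵥ (λ l → P (suc k) l - V (suc k) l)) i + V k i ≡ P (2 ℕ.+ k) i - V (2 ℕ.+ k) i
    R-step i = trans (cong (_+ V k i) (⊗ᵥ-− A (P (suc k)) (V (suc k)) i))
                     (regroup ((A ⊗ᵥ P (suc k)) i) ((A ⊗ᵥ V (suc k)) i) (V k i))
      where
      regroup : ∀ a b c → a - b + c ≡ a - (b - c)
      regroup = solve-∀

  -- 2 T_(k+1) is monic of degree k + 1.
  krylov-span : ∀ k → k < m → (∀ i → chebyshev A x (suc k) i ≡ 0ℤ) → Span (suc k) (P (suc k))
  krylov-span k k<m V≡0 = Span-cong (λ i → trans (cong (_-_ (P (suc k) i)) (V≡0 i)) (ℤₚ.+-identityʳ _))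
                                    (proj₂ (chebyshev-span k k<m))

δ : ℕ → ℕ → ℤ
δ zero    zero    = 1ℤ
δ zero    (suc _) = 0ℤ
δ (suc _) zero    = 0ℤ
δ (suc c) (suc t) = δ c t

δ-refl : ∀ c → δ c c ≡ 1ℤ
δ-refl zero    = refl
δ-refl (suc c) = δ-refl c

δ-≢ : ∀ {c t} → c ≢ t → δ c t ≡ 0ℤ
δ-≢ {zero}  {zero}  c≢t = ⊥-elim (c≢t refl)
δ-≢ {zero}  {suc t} _   = refl
δ-≢ {suc c} {zero}  _   = refl
δ-≢ {suc c} {suc t} c≢t = δ-≢ (λ c≡t → c≢t (cong suc c≡t))

at : ∀ {n} → (Fin n → ℤ) → ℕ → ℤ
at {zero}  v s       = 0ℤ
at {suc n} v zero    = v zero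
at {suc n} v (suc s) = at (λ i → v (suc i)) s

at-toℕ : ∀ {n} (v : Fin n → ℤ) (i : Fin n) → at v (toℕ i) ≡ v i
at-toℕ v zero    = refl
at-toℕ v (suc i) = at-toℕ (λ j → v (suc j)) i

at-fromℕ< : ∀ {n} (v : Fin n → ℤ) {s} (s<n : s < n) → at v s ≡ v (Fin.fromℕ< s<n)
at-fromℕ< v s<n = trans (cong (at v) (sym (Finₚ.toℕ-fromℕ< s<n))) (at-toℕ v (Fin.fromℕ< s<n))

at-≥ : ∀ {n} (v : Fin n → ℤ) {s} → n ≤ s → at v s ≡ 0ℤ
at-≥ {zero}  v         _         = refl
at-≥ {suc n} v {suc s} (s≤s n≤s) = at-≥ (λ i → v (suc i)) n≤s

at-− : ∀ {n} (v w : Fin n → ℤ) s → at (λ i → v i - w i) s ≡ at v s - at w s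
at-− {zero}  v w s       = refl
at-− {suc n} v w zero    = refl
at-− {suc n} v w (suc s) = at-− (λ i → v (suc i)) (λ i → w (suc i)) s

at-scale : ∀ {n} a (v : Fin n → ℤ) s → at (λ i → a * v i) s ≡ a * at v s
at-scale {zero}  a v s       = sym (ℤₚ.*-zeroʳ a)
at-scale {suc n} a v zero    = refl
at-scale {suc n} a v (suc s) = at-scale a (λ i → v (suc i)) s

sumFin-δ : ∀ n (v : Fin n → ℤ) c → sumFin n (λ j → δ c (toℕ j) * v j) ≡ at v c
sumFin-δ zero    v c       = refl
sumFin-δ (suc n) v zero    = begin
  1ℤ * v zero + sumFin n (λ j → 0ℤ * v (suc j))
    ≡⟨ cong₂ _+_ (ℤₚ.*-identityˡ (v zero)) (sumFin-zero n) ⟩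
  v zero + 0ℤ
    ≡⟨ ℤₚ.+-identityʳ (v zero) ⟩
  v zero ∎
sumFin-δ (suc n) v (suc c) = trans (ℤₚ.+-identityˡ _) (sumFin-δ n (λ j → v (suc j)) c)

sumOver : List ℕ → (ℕ → ℤ) → ℤ
sumOver cs f = foldr (λ c s → f c + s) 0ℤ cs

-- Vertex s of D_n is s + 1 in the paper's numbering.
neighbours : ℕ → List ℕ
neighbours 0                   = 2 ∷ []
neighbours 1                   = 2 ∷ []
neighbours 2                   = 0 ∷ 1 ∷ 3 ∷ []
neighbours (suc (suc (suc u))) = 2 ℕ.+ u ∷ 4 ℕ.+ u ∷ []

edge-indicator : ∀ s t → (if isEdge s t then 1ℤ else 0ℤ) ≡ sumOver (neighbours s) (λ c → δ c t)
edge-indicator 0 0                               = refl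
edge-indicator 0 1                               = refl
edge-indicator 0 2                               = refl
edge-indicator 0 (suc (suc (suc t)))             = refl
edge-indicator 1 0                               = refl
edge-indicator 1 1                               = refl
edge-indicator 1 2                               = refl
edge-indicator 1 (suc (suc (suc t)))             = refl
edge-indicator 2 0                               = refl
edge-indicator 2 1                               = refl
edge-indicator 2 2                               = refl
edge-indicator 2 3                               = refl
edge-indicator 2 (suc (suc (suc (suc t))))       = refl
edge-indicator (suc (suc (suc u))) 0             = refl
edge-indicator (suc (suc (suc u))) 1             = refl
edge-indicator (suc (suc (suc u))) (suc (suc t))
  with 2 ℕ.+ t ℕₚ.≟ 4 ℕ.+ u | 3 ℕ.+ u ℕₚ.≟ 3 ℕ.+ t
... | yes refl   | yes ()
... | yes refl   | no _       = sym (cong₂ (λ x y → x + (y + 0ℤ)) (δ-≢ {u} {2 ℕ.+ u} (λ ())) (δ-refl u))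
... | no _       | yes refl   = sym (cong₂ (λ x y → x + (y + 0ℤ)) (δ-refl t) (δ-≢ {2 ℕ.+ t} {t} (λ ())))
... | no 2+t≢4+u | no 3+u≢3+t =
  sym (cong₂ (λ x y → x + (y + 0ℤ)) (δ-≢ (λ u≡t → 3+u≢3+t (cong (3 ℕ.+_) u≡t)))
                                      (δ-≢ (λ 2+u≡t → 2+t≢4+u (cong (2 ℕ.+_) (sym 2+u≡t)))))

sumFin-sumOver-δ : ∀ n (v : Fin n → ℤ) cs →
                   sumFin n (λ j → sumOver cs (λ c → δ c (toℕ j)) * v j) ≡ sumOver cs (at v)
sumFin-sumOver-δ n v []       = sumFin-zero n
sumFin-sumOver-δ n v (c ∷ cs) = begin
  sumFin n (λ j → (δ c (toℕ j) + sumOver cs (λ c′ → δ c′ (toℕ j))) * v j)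
    ≡⟨ sumFin-cong n (λ j → ℤₚ.*-distribʳ-+ (v j) (δ c (toℕ j)) _) ⟩
  sumFin n (λ j → δ c (toℕ j) * v j + sumOver cs (λ c′ → δ c′ (toℕ j)) * v j)
    ≡⟨ sumFin-+ n _ _ ⟩
  sumFin n (λ j → δ c (toℕ j) * v j) +
  sumFin n (λ j → sumOver cs (λ c′ → δ c′ (toℕ j)) * v j)
    ≡⟨ cong₂ _+_ (sumFin-δ n v c) (sumFin-sumOver-δ n v cs) ⟩
  at v c + sumOver cs (at v) ∎

adjD-action : ∀ n (v : Fin n → ℤ) {s} → s < n →
              at (adjD n ⊗ᵥ v) s ≡ sumOver (neighbours s) (at v)
adjD-action n v {s} s<n = begin
  at (adjD n ⊗ᵥ v) s
    ≡⟨ at-fromℕ< (adjD n ⊗ᵥ v) s<n ⟩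
  sumFin n (λ j → adjD n i j * v j)
    ≡⟨ sumFin-cong n (λ j → cong (_* v j) (edge-indicator (toℕ i) (toℕ j))) ⟩
  sumFin n (λ j → sumOver (neighbours (toℕ i)) (λ c → δ c (toℕ j)) * v j)
    ≡⟨ sumFin-sumOver-δ n v (neighbours (toℕ i)) ⟩
  sumOver (neighbours (toℕ i)) (at v)
    ≡⟨ cong (λ s → sumOver (neighbours s) (at v)) (Finₚ.toℕ-fromℕ< s<n) ⟩
  sumOver (neighbours s) (at v) ∎
  where
  i = Fin.fromℕ< s<n

-- Folding D_n onto a path

-- Merges the twin leaves 0 and 1 of D_n into vertex 0 of a path.
fold : (ℕ → ℤ) → ℕ → ℤ
fold f zero    = f 0 + f 1
fold f (suc t) = f (2 ℕ.+ t)

-- Adjacency operator of the path 0 — 1 — 2 — ⋯ in which the edge at 0 is counted twice.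
pathAdj : (ℕ → ℤ) → ℕ → ℤ
pathAdj g zero    = g 1 + g 1
pathAdj g (suc t) = g t + g (2 ℕ.+ t)

-- By images-zero, images-one and images-suc-suc, images k g = 2 T_k(pathAdj/2) g.
images : ℕ → (ℕ → ℤ) → ℕ → ℤ
images k g t = g ∣ t - k ∣ + g (t ℕ.+ k)

pathAdj-cong : ∀ {g h} t → (∀ s → s ≤ suc t → g s ≡ h s) → pathAdj g t ≡ pathAdj h t
pathAdj-cong zero    g≡h = cong₂ _+_ (g≡h 1 ℕₚ.≤-refl) (g≡h 1 ℕₚ.≤-refl)
pathAdj-cong (suc t) g≡h = cong₂ _+_ (g≡h t (ℕₚ.m≤n+m t 2)) (g≡h (2 ℕ.+ t) ℕₚ.≤-refl)

images-zero : ∀ g t → images 0 g t ≡ g t + g t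
images-zero g t = cong₂ (λ x y → g x + g y) (ℕₚ.∣-∣-identityʳ t) (ℕₚ.+-identityʳ t)

images-one : ∀ g t → images 1 g t ≡ pathAdj g t
images-one g zero    = refl
images-one g (suc t) = cong₂ (λ x y → g x + g y) (ℕₚ.∣-∣-identityʳ t) (ℕₚ.+-comm (suc t) 1)

images-suc-suc : ∀ k g t → images (2 ℕ.+ k) g t ≡ pathAdj (images (suc k) g) t - images k g t
images-suc-suc k g zero    = sym (cancel (g k) (g (2 ℕ.+ k)))
  where
  cancel : ∀ a b → (a + b) + (a + b) - (a + a) ≡ b + b
  cancel = solve-∀
images-suc-suc k g (suc t) = begin
  a + d                     ≡⟨ cancel a b c d ⟨
  a + b + (c + d) - (c + b) ≡⟨ cong₂ (λ x y → a + g x + (c + g y) - (c + b))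
                                     (sym (ℕₚ.+-suc t k)) (cong suc (ℕₚ.+-suc t (suc k))) ⟩
  pathAdj (images (suc k) g) (suc t) - images k g (suc t) ∎
  where
  a = g (∣ t - suc k ∣)
  b = g (suc t ℕ.+ k)
  c = g (∣ suc t - k ∣)
  d = g (suc t ℕ.+ (2 ℕ.+ k))
  cancel : ∀ a b c d → a + b + (c + d) - (c + b) ≡ a + d
  cancel = solve-∀

OddAbout : ℕ → (ℕ → ℤ) → Set
OddAbout m g = ∀ r → r ≤ m → g (m ∸ r) + g (m ℕ.+ r) ≡ 0ℤ

module _ {m : ℕ} (g : ℕ → ℤ) (odd : OddAbout m g) where

  images-at-centre : ∀ {k} → k ≤ m → images k g m ≡ 0ℤ
  images-at-centre {k} k≤m =
    trans (cong (λ s → g s + g (m ℕ.+ k)) (ℕₚ.m≤n⇒∣n-m∣≡n∸m k≤m)) (odd k k≤m)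

  images-centred : ∀ {t} → t ≤ m → images m g t ≡ 0ℤ
  images-centred {t} t≤m =
    trans (cong₂ (λ x y → g x + g y) (ℕₚ.m≤n⇒∣m-n∣≡n∸m t≤m) (ℕₚ.+-comm t m)) (odd t t≤m)

oddExtension : ℕ → (ℕ → ℤ) → ℕ → ℤ
oddExtension m f t with t ℕₚ.≤? m
... | yes _ = f t
... | no  _ = - f (m ℕ.+ m ∸ t)

module _ (m : ℕ) (f : ℕ → ℤ) where

  oddExtension-≤ : ∀ {t} → t ≤ m → oddExtension m f t ≡ f t
  oddExtension-≤ {t} t≤m with t ℕₚ.≤? m
  ... | yes _   = refl
  ... | no  t≰m = ⊥-elim (t≰m t≤m)

  oddExtension-odd : f m ≡ 0ℤ → OddAbout m (oddExtension m f)
  oddExtension-odd fm≡0 zero    _ = begin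
    oddExtension m f m + oddExtension m f (m ℕ.+ 0)
      ≡⟨ cong₂ _+_ (oddExtension-≤ ℕₚ.≤-refl)
                   (trans (cong (oddExtension m f) (ℕₚ.+-identityʳ m)) (oddExtension-≤ ℕₚ.≤-refl)) ⟩
    f m + f m
      ≡⟨ cong₂ _+_ fm≡0 fm≡0 ⟩
    0ℤ ∎
  oddExtension-odd fm≡0 (suc r) _ with m ℕ.+ suc r ℕₚ.≤? m
  ... | yes m+1+r≤m = ⊥-elim (ℕₚ.m+1+n≰m m m+1+r≤m)
  ... | no  _       = begin
    oddExtension m f (m ∸ suc r) + - f (m ℕ.+ m ∸ (m ℕ.+ suc r))
      ≡⟨ cong₂ (λ x y → x + - f y) (oddExtension-≤ (ℕₚ.m∸n≤m m (suc r)))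
                                   (ℕₚ.[m+n]∸[m+o]≡n∸o m m (suc r)) ⟩
    f (m ∸ suc r) + - f (m ∸ suc r)
      ≡⟨ ℤₚ.+-inverseʳ (f (m ∸ suc r)) ⟩
    0ℤ ∎

-- The vanishing of 2 T_m(A/2) on twin-symmetric vectors

-- D_n for n = m + 1 = k + 2; the argument needs only m ≥ 1, not the paper's m ≥ 3.
module Dₙ (k : ℕ) where

  m n : ℕ
  m = suc k
  n = suc m

  private
    A = adjD n

  Twin : (Fin n → ℤ) → Set
  Twin v = v zero ≡ v (suc zero)

  Twin-adj : (v : Fin n → ℤ) → Twin (A ⊗ᵥ v)
  Twin-adj v = trans (adjD-action n v (s≤s z≤n)) (sym (adjD-action n v (s≤s (s≤s z≤n))))

  Twin-krylov : ∀ {x} → Twin x → ∀ j → Twin (krylov A x j)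
  Twin-krylov     twin zero    = twin
  Twin-krylov {x} twin (suc j) = Twin-adj (krylov A x j)

  Twin-chebyshev : ∀ {x} → Twin x → ∀ j → Twin (chebyshev A x j)
  Twin-chebyshev     twin zero          = cong (+ 2 *_) twin
  Twin-chebyshev {x} twin (suc zero)    = Twin-adj x
  Twin-chebyshev {x} twin (suc (suc j)) =
    cong₂ _-_ (Twin-adj (chebyshev A x (suc j))) (Twin-chebyshev twin j)

  fold-adj : (v : Fin n → ℤ) {t : ℕ} → t < m → fold (at (A ⊗ᵥ v)) t ≡ pathAdj (fold (at v)) t
  fold-adj v {zero} _ =
    trans (cong₂ _+_ (adjD-action n v (s≤s z≤n)) (adjD-action n v (s≤s (s≤s z≤n)))) (drop-zeros (at v 2))
    where
    drop-zeros : ∀ a → (a + 0ℤ) + (a + 0ℤ) ≡ a + a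
    drop-zeros = solve-∀
  fold-adj v {suc zero} (s≤s 1≤k) =
    trans (adjD-action n v (s≤s (s≤s 1≤k))) (regroup (at v 0) (at v 1) (at v 3))
    where
    regroup : ∀ a b c → a + (b + (c + 0ℤ)) ≡ a + b + c
    regroup = solve-∀
  fold-adj v {suc (suc u)} 2+u<m =
    trans (adjD-action n v (s≤s 2+u<m)) (cong (_+_ (at v (2 ℕ.+ u))) (ℤₚ.+-identityʳ _))

  fold-boundary : (v : Fin n → ℤ) → fold (at v) m ≡ 0ℤ
  fold-boundary v = at-≥ v ℕₚ.≤-refl

  fold-at-− : (v w : Fin n → ℤ) (t : ℕ) → fold (at (λ i → v i - w i)) t ≡ fold (at v) t - fold (at w) t
  fold-at-− v w zero    =
    trans (cong₂ _+_ (at-− v w 0) (at-− v w 1)) (regroup (at v 0) (at w 0) (at v 1) (at w 1))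
    where
    regroup : ∀ a b c d → (a - b) + (c - d) ≡ (a + c) - (b + d)
    regroup = solve-∀
  fold-at-− v w (suc t) = at-− v w (2 ℕ.+ t)

  fold-at-scale : (a : ℤ) (v : Fin n → ℤ) (t : ℕ) → fold (at (λ i → a * v i)) t ≡ a * fold (at v) t
  fold-at-scale a v zero    =
    trans (cong₂ _+_ (at-scale a v 0) (at-scale a v 1)) (sym (ℤₚ.*-distribˡ-+ a (at v 0) (at v 1)))
  fold-at-scale a v (suc t) = at-scale a v (2 ℕ.+ t)

  module _ (x : Fin n → ℤ) where

    private
      V = chebyshev A x

      g : ℕ → ℤ
      g = oddExtension m (fold (at x))

      g-odd : OddAbout m g
      g-odd = oddExtension-odd m (fold (at x)) (fold-boundary x)

    -- Method of images: reflecting oddly about m makes each images j g vanish at m,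
    -- as fold (at v) does for every vector v.
    Agrees : ℕ → Set
    Agrees j = ∀ t → t ≤ m → fold (at (V j)) t ≡ images j g t

    agrees-below : ∀ {j} → j ≤ m → (∀ t → t < m → fold (at (V j)) t ≡ images j g t) → Agrees j
    agrees-below {j} j≤m below t t≤m with ℕₚ.m≤n⇒m<n∨m≡n t≤m
    ... | inj₁ t<m  = below t t<m
    ... | inj₂ refl = trans (fold-boundary (V j)) (sym (images-at-centre g g-odd j≤m))

    agrees-zero : Agrees 0
    agrees-zero t t≤m = begin
      fold (at (λ i → + 2 * x i)) t ≡⟨ fold-at-scale (+ 2) x t ⟩
      + 2 * fold (at x) t           ≡⟨ double (fold (at x) t) ⟩
      fold (at x) t + fold (at x) t ≡⟨ cong (λ y → y + y) (oddExtension-≤ m _ t≤m) ⟨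
      g t + g t                     ≡⟨ images-zero g t ⟨
      images 0 g t                  ∎
      where
      double : ∀ a → + 2 * a ≡ a + a
      double = solve-∀

    agrees-one : Agrees 1
    agrees-one = agrees-below (s≤s z≤n) λ t t<m → begin
      fold (at (A ⊗ᵥ x)) t
        ≡⟨ fold-adj x t<m ⟩
      pathAdj (fold (at x)) t
        ≡⟨ pathAdj-cong t (λ s s≤1+t → sym (oddExtension-≤ m _ (ℕₚ.≤-trans s≤1+t t<m))) ⟩
      pathAdj g t
        ≡⟨ images-one g t ⟨
      images 1 g t ∎

    agrees-suc-suc : ∀ {j} → 2 ℕ.+ j ≤ m → Agrees j → Agrees (suc j) → Agrees (2 ℕ.+ j)
    agrees-suc-suc {j} 2+j≤m agrees-j agrees-1+j = agrees-below 2+j≤m λ t t<m → begin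
      fold (at (λ i → (A ⊗ᵥ V (suc j)) i - V j i)) t
        ≡⟨ fold-at-− (A ⊗ᵥ V (suc j)) (V j) t ⟩
      fold (at (A ⊗ᵥ V (suc j))) t - fold (at (V j)) t
        ≡⟨ cong₂ _-_ (fold-adj (V (suc j)) t<m) (agrees-j t (ℕₚ.<⇒≤ t<m)) ⟩
      pathAdj (fold (at (V (suc j)))) t - images j g t
        ≡⟨ cong (_- images j g t) (pathAdj-cong t (λ s s≤1+t → agrees-1+j s (ℕₚ.≤-trans s≤1+t t<m))) ⟩
      pathAdj (images (suc j) g) t - images j g t
        ≡⟨ images-suc-suc j g t ⟨
      images (2 ℕ.+ j) g t ∎

    agrees : ∀ j → suc j ≤ m → Agrees j × Agrees (suc j)
    agrees zero    _     = agrees-zero , agrees-one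
    agrees (suc j) 2+j≤m =
      let (agrees-j , agrees-1+j) = agrees j (ℕₚ.≤-trans (ℕₚ.n≤1+n _) 2+j≤m)
      in agrees-1+j , agrees-suc-suc 2+j≤m agrees-j agrees-1+j

    fold-chebyshev-vanishes : ∀ t → t ≤ m → fold (at (V m)) t ≡ 0ℤ
    fold-chebyshev-vanishes t t≤m = trans (proj₂ (agrees k ℕₚ.≤-refl) t t≤m) (images-centred g g-odd t≤m)

    chebyshev-vanishes : Twin x → ∀ i → V m i ≡ 0ℤ
    chebyshev-vanishes twin i = trans (sym (at-toℕ (V m) i)) (vanishes (toℕ i))
      where
      twice≡0 : ∀ {a} → a + a ≡ 0ℤ → a ≡ 0ℤ
      twice≡0 {a} a+a≡0 = ℤₚ.*-cancelˡ-≡ (+ 2) a 0ℤ (trans (double a) a+a≡0)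
        where
        double : ∀ a → + 2 * a ≡ a + a
        double = solve-∀
      V₁≡0 : V m (suc zero) ≡ 0ℤ
      V₁≡0 = twice≡0 (trans (cong (_+ V m (suc zero)) (sym (Twin-chebyshev twin m)))
                            (fold-chebyshev-vanishes 0 z≤n))
      vanishes : ∀ s → at (V m) s ≡ 0ℤ
      vanishes zero          = trans (Twin-chebyshev twin m) V₁≡0
      vanishes (suc zero)    = V₁≡0
      vanishes (suc (suc u)) with suc u ℕₚ.≤? m
      ... | yes 1+u≤m = fold-chebyshev-vanishes (suc u) 1+u≤m
      ... | no  1+u≰m = at-≥ (V m) (ℕₚ.m≤n⇒m≤1+n (ℕₚ.≰⇒> 1+u≰m))

  -- Reduction of W(D_n) to the padded matrix

  private
    e : Fin n → ℤ
    e _ = 1ℤ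

    last : Fin n
    last = Fin.fromℕ m

  powE≡krylov : ∀ j i → powE n j i ≡ krylov A e j i
  powE≡krylov zero    i = refl
  powE≡krylov (suc j) i = ⊗ᵥ-cong A (powE≡krylov j) i

  W-twin : ∀ j → W n zero j ≡ W n (suc zero) j
  W-twin j = begin
    powE n (toℕ j) zero           ≡⟨ powE≡krylov (toℕ j) zero ⟩
    krylov A e (toℕ j) zero       ≡⟨ Twin-krylov refl (toℕ j) ⟩
    krylov A e (toℕ j) (suc zero) ≡⟨ powE≡krylov (toℕ j) (suc zero) ⟨
    powE n (toℕ j) (suc zero)     ∎

  open KrylovSpan A e using (Span; combination; krylov-span)

  last-column-span : Span m (krylov A e m)
  last-column-span = krylov-span k ℕₚ.≤-refl (chebyshev-vanishes e refl)

  private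
    c : ℕ → ℤ
    c = proj₁ last-column-span

  -- Right multiplication by transvection last clear subtracts from the last column of W its
  -- expansion in the other columns.
  clear : Fin n → ℤ
  clear j = - c (toℕ j)

  clear-last : clear last ≡ 0ℤ
  clear-last = cong -_ (trans (cong c (Finₚ.toℕ-fromℕ m)) (proj₁ (proj₂ last-column-span) m ℕₚ.≤-refl))

  W-clear : ∀ i → sumFin n (λ j → W n i j * clear j) ≡ - W n i last
  W-clear i = begin
    sumFin n (λ j → powE n (toℕ j) i * - c (toℕ j))
      ≡⟨ sumFin-cong n (λ j → trans (cong (_* - c (toℕ j)) (powE≡krylov (toℕ j) i))
                                    (negate (krylov A e (toℕ j) i) (c (toℕ j)))) ⟩
    sumFin n (λ j → -1ℤ * (c (toℕ j) * krylov A e (toℕ j) i))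
      ≡⟨ sumFin-*ˡ n -1ℤ (λ j → c (toℕ j) * krylov A e (toℕ j) i) ⟩
    -1ℤ * combination c i
      ≡⟨ cong (-1ℤ *_) (proj₂ (proj₂ last-column-span) i) ⟨
    -1ℤ * krylov A e m i
      ≡⟨ ℤₚ.-1*i≡-i _ ⟩
    - krylov A e m i
      ≡⟨ cong -_ (trans (sym (powE≡krylov m i)) (cong (λ s → powE n s i) (sym (Finₚ.toℕ-fromℕ m)))) ⟩
    - W n i last ∎
    where
    negate : ∀ p c → p * - c ≡ -1ℤ * (c * p)
    negate = solve-∀

  W′ : Mat n n
  W′ = W n ⊗ transvection last clear

  W′-entry : ∀ i j → W′ i j ≡ W n i j - I n j last * W n i last
  W′-entry i j = begin
    W′ i j
      ≡⟨ ⊗-transvection last clear (W n) i j ⟩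
    W n i j + I n j last * sumFin n (λ l → W n i l * clear l)
      ≡⟨ cong (λ y → W n i j + I n j last * y) (W-clear i) ⟩
    W n i j + I n j last * - W n i last
      ≡⟨ move (W n i j) (I n j last) (W n i last) ⟩
    W n i j - I n j last * W n i last ∎
    where
    move : ∀ a b c → a + b * - c ≡ a - b * c
    move = solve-∀

  W′-twin : ∀ j → W′ zero j ≡ W′ (suc zero) j
  W′-twin j = trans (W′-entry zero j)
    (trans (cong₂ (λ a b → a - I n j last * b) (W-twin j) (W-twin last)) (sym (W′-entry (suc zero) j)))

  -e₀ : Fin n → ℤ
  -e₀ l = - I n zero l

  dropRow₀ : Mat n n
  dropRow₀ = transvection (suc zero) -e₀

  dropRow₀-below : ∀ i j → (dropRow₀ ⊗ W′) (suc i) j ≡ W n (suc i) j - I n j last * W n (suc i) last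
  dropRow₀-below i j = begin
    (dropRow₀ ⊗ W′) (suc i) j ≡⟨ transvection-⊗ (suc zero) -e₀ W′ (suc i) j ⟩
    W′ (suc i) j + 0ℤ         ≡⟨ ℤₚ.+-identityʳ _ ⟩
    W′ (suc i) j              ≡⟨ W′-entry (suc i) j ⟩
    W n (suc i) j - I n j last * W n (suc i) last ∎

  dropRow₀-W′ : (dropRow₀ ⊗ W′) ≐ padded m
  dropRow₀-W′ zero j = begin
    (dropRow₀ ⊗ W′) zero j            ≡⟨ transvection-⊗ (suc zero) -e₀ W′ zero j ⟩
    W′ zero j + -1ℤ * W′ (suc zero) j ≡⟨ cong (λ y → W′ zero j + -1ℤ * y) (W′-twin j) ⟨
    W′ zero j + -1ℤ * W′ zero j       ≡⟨ cancel (W′ zero j) ⟩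
    0ℤ                                ∎
    where
    cancel : ∀ a → a + -1ℤ * a ≡ 0ℤ
    cancel = solve-∀
  dropRow₀-W′ (suc i) j with toℕ j ℕₚ.<? m
  ... | yes j<m = begin
    (dropRow₀ ⊗ W′) (suc i) j
      ≡⟨ dropRow₀-below i j ⟩
    W n (suc i) j - I n j last * W n (suc i) last
      ≡⟨ cong (λ δ → W n (suc i) j - δ * W n (suc i) last) (I-off j≢last) ⟩
    W n (suc i) j - 0ℤ * W n (suc i) last
      ≡⟨ ℤₚ.+-identityʳ _ ⟩
    powE n (toℕ j) (suc i)
      ≡⟨ cong (λ s → powE n s (suc i)) (sym (trans (Finₚ.toℕ-inject₁ _) (Finₚ.toℕ-fromℕ< j<m))) ⟩
    Ŵ m i (Fin.fromℕ< j<m) ∎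
    where
    j≢last : j ≢ last
    j≢last j≡last = ℕₚ.<-irrefl (trans (cong toℕ j≡last) (Finₚ.toℕ-fromℕ m)) j<m
  ... | no j≮m = begin
    (dropRow₀ ⊗ W′) (suc i) j
      ≡⟨ dropRow₀-below i j ⟩
    W n (suc i) j - I n j last * W n (suc i) last
      ≡⟨ cong (λ l → W n (suc i) l - I n l last * W n (suc i) last) j≡last ⟩
    W n (suc i) last - I n last last * W n (suc i) last
      ≡⟨ cong (λ δ → W n (suc i) last - δ * W n (suc i) last) (I-diag last) ⟩
    W n (suc i) last - 1ℤ * W n (suc i) last
      ≡⟨ cancel (W n (suc i) last) ⟩
    0ℤ ∎
    where
    j≡last : j ≡ last
    j≡last = Finₚ.toℕ-injective
      (trans (ℕₚ.≤-antisym (ℕₚ.≤-pred (Finₚ.toℕ<n j)) (ℕₚ.≮⇒≥ j≮m)) (sym (Finₚ.toℕ-fromℕ m)))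
    cancel : ∀ a → a - 1ℤ * a ≡ 0ℤ
    cancel = solve-∀

  W∼padded : W n ∼ padded m
  W∼padded =
    ∼-trans (∼-⊗ʳ (W n) (transvection last clear) (Unimodular-transvection last clear clear-last))
            (∼-respʳ (∼-⊗ˡ dropRow₀ W′ (Unimodular-transvection (suc zero) -e₀ refl)) dropRow₀-W′)

lemma4p4 : (m : ℕ) → 3 ≤ m → SameSNF (suc m) (W (suc m)) (padded m)
lemma4p4 (suc k) _ = ∼⇒SameSNF (Dₙ.W∼padded k)
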